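{- Let $F$ be a finite field with $q$ elements and let $V$ be a vector space over $F$ of finite dimension $n\ge 1$. If $q$ is odd, then the linear dependence graph $\Gamma(V)$ is Eulerian, i.e. it has a closed walk using every edge exactly once.
   Context: For a finite-dimensional vector space $V$ over a finite field $F$, the linear dependence graph $\Gamma(V)$ is the simple graph whose vertex set is $V$, two vertices $a,b$ being adjacent if and only if $a\neq b$ and $\{a,b\}$ is linearly dependent. -}

module Defs where

open import Level using (Level; _⊔_)
open import Data.Nat using (ℕ; suc)
open import Data.Fin using (Fin; zero; suc; inject₁; fromℕ)
open import Data.Vec using (Vec; zipWith; map; replicate)
open import Data.Product using (Σ; ∃; ∃!; _×_; _,_)
open import Data.Sum using (_⊎_)
open import Relation.Nullary using (¬_)
open import Relation.Binary.PropositionalEquality using (_≡_; _≢_)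
open import Function.Bundles using (_↔_)
open import Algebra.Bundles using (CommutativeRing)

record IsFiniteField {c ℓ} (F : CommutativeRing c ℓ) (q : ℕ) : Set (c ⊔ ℓ) where
  open CommutativeRing F
  field
    ≈⇒≡      : ∀ {x y} → x ≈ y → x ≡ y
    1≢0      : 1# ≢ 0#
    inverse  : ∀ x → x ≢ 0# → Σ Carrier λ y → x * y ≡ 1#
    counting : Carrier ↔ Fin q

-- The coordinate vector space Fⁿ (every n-dimensional vector space over F
-- is isomorphic to it, and Γ(V) is an isomorphism invariant).
module VectorSpace {c ℓ} (F : CommutativeRing c ℓ) (n : ℕ) where
  open CommutativeRing F

  V : Set c
  V = Vec Carrier n

  _⊕_ : V → V → V
  _⊕_ = zipWith _+_

  _·_ : Carrier → V → V
  λ' · v = map (λ' *_) v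

  𝟎 : V
  𝟎 = replicate n 0#

  LinearlyDependent₂ : V → V → Set c
  LinearlyDependent₂ a b =
    Σ Carrier λ λ' → Σ Carrier λ μ →
      ¬ (λ' ≡ 0# × μ ≡ 0#) × ((λ' · a) ⊕ (μ · b)) ≡ 𝟎

  Adj : V → V → Set c
  Adj a b = a ≢ b × LinearlyDependent₂ a b

module _ {v e} {Vtx : Set v} (Adj : Vtx → Vtx → Set e) where

  record ClosedWalk : Set (v ⊔ e) where
    field
      len    : ℕ
      vertex : Fin (suc len) → Vtx
      closed : vertex zero ≡ vertex (fromℕ len)
      steps  : ∀ (i : Fin len) → Adj (vertex (inject₁ i)) (vertex (suc i))

    Traverses : Fin len → Vtx → Vtx → Set v
    Traverses i a b =
      (vertex (inject₁ i) ≡ a × vertex (suc i) ≡ b) ⊎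
      (vertex (inject₁ i) ≡ b × vertex (suc i) ≡ a)

  Eulerian : Set (v ⊔ e)
  Eulerian = Σ ClosedWalk λ W → let open ClosedWalk W in
    ∀ a b → Adj a b → ∃! _≡_ (λ i → Traverses i a b)

{-# OPTIONS --safe #-}
-- Two distinct vectors of V = Fⁿ are adjacent in Γ(V) exactly when they lie on a common line
-- through 0, and that line is then unique. So Γ(V) is the union of the complete graphs on the
-- lines, which are pairwise edge-disjoint and all pass through 0. A line has q = 2m + 1 points,
-- and the complete graph K_{2m+1} has an Euler circuit through any given vertex (by induction on
-- m, adding two vertices at a time). Transporting it to every line, based at 0, and
-- concatenating the resulting closed walks gives an Euler circuit of Γ(V).
module Submission where

open import Defs
open import Level using (Level; _⊔_)
open import Algebra.Bundles using (CommutativeRing)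
open import Data.Empty using (⊥-elim)
open import Data.Fin as Fin using (Fin; zero; suc; inject₁; fromℕ; _↑ˡ_; _↑ʳ_; splitAt)
open import Data.Fin.Properties
  using (suc-injective; ↑ˡ-injective; ↑ʳ-injective; splitAt-↑ˡ; splitAt-↑ʳ; splitAt⁻¹-↑ˡ;
         splitAt⁻¹-↑ʳ)
open import Data.List using (List; []; _∷_; _++_; map; concatMap; tabulate; lookup; allFin; length)
open import Data.List.Relation.Unary.All as All using (All; []; _∷_)
import Data.List.Relation.Unary.All.Properties as All
open import Data.List.Relation.Unary.Any using (Any; here; there)
open import Data.Nat as ℕ using (ℕ; zero; suc; _/_; _≥_; _%_)
open import Data.Nat.DivMod using (m≡m%n+[m/n]*n)
open import Data.Nat.Properties using (*-comm; +-identityʳ)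
open import Data.Product as Product using (Σ-syntax; ∃!; _×_; _,_; proj₁; proj₂; uncurry)
open import Data.Sum using (_⊎_; inj₁; inj₂)
open import Data.Vec using (Vec; []; _∷_; replicate)
import Data.Vec.Properties as Vec
open import Function using (_∘_; Injective)
open import Function.Bundles using (Inverse)
open import Relation.Binary.Definitions using (DecidableEquality)
open import Relation.Binary.PropositionalEquality
  using (_≡_; _≢_; refl; sym; trans; cong; cong₂; subst; module ≡-Reasoning)
open import Relation.Nullary using (¬_; yes; no)
import Relation.Nullary.Decidable as Dec

private variable
  a b e p : Level
  A : Set a
  B : Set b

None : (A → Set p) → List A → Set _
None P = All (¬_ ∘ P)

data ExactlyOnce {A : Set a} (P : A → Set p) : List A → Set (a ⊔ p) where
  here  : ∀ {x xs} → P x → None P xs → ExactlyOnce P (x ∷ xs)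
  there : ∀ {x xs} → ¬ P x → ExactlyOnce P xs → ExactlyOnce P (x ∷ xs)

module Once {P : A → Set p} where

  toAny : ∀ {xs} → ExactlyOnce P xs → Any P xs
  toAny (here px _)    = here px
  toAny (there _ once) = there (toAny once)

  ++⁺ˡ : ∀ {xs ys} → ExactlyOnce P xs → None P ys → ExactlyOnce P (xs ++ ys)
  ++⁺ˡ (here px none)   none′ = here px (All.++⁺ none none′)
  ++⁺ˡ (there ¬px once) none′ = there ¬px (++⁺ˡ once none′)

  ++⁺ʳ : ∀ {xs ys} → None P xs → ExactlyOnce P ys → ExactlyOnce P (xs ++ ys)
  ++⁺ʳ []           once = once
  ++⁺ʳ (¬px ∷ none) once = there ¬px (++⁺ʳ none once)

  resp : ∀ {q} {Q : A → Set q} {xs} → (∀ {x} → P x → Q x) → (∀ {x} → Q x → P x) →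
         ExactlyOnce P xs → ExactlyOnce Q xs
  resp to from (here px none)   = here (to px) (All.map (_∘ from) none)
  resp to from (there ¬px once) = there (¬px ∘ from) (resp to from once)

  map⁺ : ∀ {f : B → A} {xs} → ExactlyOnce (P ∘ f) xs → ExactlyOnce P (map f xs)
  map⁺ (here px none)   = here px (All.map⁺ none)
  map⁺ (there ¬px once) = there ¬px (map⁺ once)

  concatMap⁺ : ∀ {f : B → List A} {j js} → ExactlyOnce (j ≡_) js → ExactlyOnce P (f j) →
               All (λ i → j ≢ i → None P (f i)) js → ExactlyOnce P (concatMap f js)
  concatMap⁺ {f = f} {j} (here refl others) once (_ ∷ nones) = ++⁺ˡ once (rest others nones)
    where
    rest : ∀ {is} → None (j ≡_) is → All (λ i → j ≢ i → None P (f i)) is → None P (concatMap f is)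
    rest []              []             = []
    rest (j≢i ∷ others′) (none ∷ nones′) = All.++⁺ (none j≢i) (rest others′ nones′)
  concatMap⁺ (there j≢i others) once (none ∷ nones) = ++⁺ʳ (none j≢i) (concatMap⁺ others once nones)

  tabulate⁺ : ∀ {n} {f : Fin n → A} i → P (f i) → (∀ j → j ≢ i → ¬ P (f j)) →
              ExactlyOnce P (tabulate f)
  tabulate⁺ zero    pfi others = here pfi (All.tabulate⁺ (λ j → others (suc j) λ ()))
  tabulate⁺ (suc i) pfi others =
    there (others zero λ ()) (tabulate⁺ i pfi (λ j j≢i → others (suc j) (j≢i ∘ suc-injective)))

allFin-once : ∀ {n} (i : Fin n) → ExactlyOnce (i ≡_) (allFin n)
allFin-once i = Once.tabulate⁺ i refl (λ j j≢i i≡j → j≢i (sym i≡j))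

-- The walk u, v₁, …, vₖ is represented by its start u and the list v₁ ∷ … ∷ vₖ.
steps : A → List A → List (A × A)
steps u []       = []
steps u (v ∷ vs) = (u , v) ∷ steps v vs

endpoint : A → List A → A
endpoint u []       = u
endpoint u (v ∷ vs) = endpoint v vs

steps-++ : ∀ (u : A) xs ys → steps u (xs ++ ys) ≡ steps u xs ++ steps (endpoint u xs) ys
steps-++ u []       ys = refl
steps-++ u (x ∷ xs) ys = cong ((u , x) ∷_) (steps-++ x xs ys)

endpoint-++ : ∀ (u : A) xs ys → endpoint u (xs ++ ys) ≡ endpoint (endpoint u xs) ys
endpoint-++ u []       ys = refl
endpoint-++ u (x ∷ xs) ys = endpoint-++ x xs ys

steps-map : ∀ (f : A → B) u xs → steps (f u) (map f xs) ≡ map (Product.map f f) (steps u xs)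
steps-map f u []       = refl
steps-map f u (x ∷ xs) = cong ((f u , f x) ∷_) (steps-map f x xs)

endpoint-map : ∀ (f : A → B) u xs → endpoint (f u) (map f xs) ≡ f (endpoint u xs)
endpoint-map f u []       = refl
endpoint-map f u (x ∷ xs) = endpoint-map f x xs

module _ {I : Set b} (f : I → List A) (u : A) where

  IsClosedAt : I → Set _
  IsClosedAt i = endpoint u (f i) ≡ u

  endpoint-concatMap : ∀ {is} → All IsClosedAt is → endpoint u (concatMap f is) ≡ u
  endpoint-concatMap []                      = refl
  endpoint-concatMap {i ∷ is} (closed ∷ cs) = begin
    endpoint u (f i ++ concatMap f is)
      ≡⟨ endpoint-++ u (f i) _ ⟩
    endpoint (endpoint u (f i)) (concatMap f is)
      ≡⟨ cong (λ v → endpoint v (concatMap f is)) closed ⟩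
    endpoint u (concatMap f is)
      ≡⟨ endpoint-concatMap cs ⟩
    u ∎
    where open ≡-Reasoning

  steps-concatMap : ∀ {is} → All IsClosedAt is →
                    steps u (concatMap f is) ≡ concatMap (steps u ∘ f) is
  steps-concatMap []                      = refl
  steps-concatMap {i ∷ is} (closed ∷ cs) = begin
    steps u (f i ++ concatMap f is)
      ≡⟨ steps-++ u (f i) _ ⟩
    steps u (f i) ++ steps (endpoint u (f i)) (concatMap f is)
      ≡⟨ cong (λ v → steps u (f i) ++ steps v (concatMap f is)) closed ⟩
    steps u (f i) ++ steps u (concatMap f is)
      ≡⟨ cong (steps u (f i) ++_) (steps-concatMap cs) ⟩
    steps u (f i) ++ concatMap (steps u ∘ f) is ∎
    where open ≡-Reasoning

-- A data type rather than the sum of equations of ClosedWalk.Traverses, so that a step differing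
-- from the edge in a constructor is refuted by λ ().
data Traverses {A : Set a} (x y : A) : A × A → Set a where
  forward  : Traverses x y (x , y)
  backward : Traverses x y (y , x)

Traverses-sym : ∀ {x y : A} {s} → Traverses x y s → Traverses y x s
Traverses-sym forward  = backward
Traverses-sym backward = forward

Traverses⇒≡ : ∀ {x y : A} {s} → Traverses x y s →
              (proj₁ s ≡ x × proj₂ s ≡ y) ⊎ (proj₁ s ≡ y × proj₂ s ≡ x)
Traverses⇒≡ forward  = inj₁ (refl , refl)
Traverses⇒≡ backward = inj₂ (refl , refl)

≡⇒Traverses : ∀ {x y u v : A} → (u ≡ x × v ≡ y) ⊎ (u ≡ y × v ≡ x) → Traverses x y (u , v)
≡⇒Traverses (inj₁ (refl , refl)) = forward
≡⇒Traverses (inj₂ (refl , refl)) = backward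

Traverses-map : ∀ (f : A → B) {x y} s → Traverses x y s → Traverses (f x) (f y) (Product.map f f s)
Traverses-map f _ forward  = forward
Traverses-map f _ backward = backward

Traverses-map⁻ : ∀ {f : A → B} → Injective _≡_ _≡_ f → ∀ {x y} s →
                 Traverses (f x) (f y) (Product.map f f s) → Traverses x y s
Traverses-map⁻ f-inj s t with Traverses⇒≡ t
... | inj₁ (p , q) = ≡⇒Traverses (inj₁ (f-inj p , f-inj q))
... | inj₂ (p , q) = ≡⇒Traverses (inj₂ (f-inj p , f-inj q))

none-touching : ∀ {Q : A → Set p} {x y ss} → All (λ (u , v) → Q u ⊎ Q v) ss → ¬ Q x → ¬ Q y →
                None (Traverses x y) ss
none-touching {Q = Q} {x} {y} touching ¬Qx ¬Qy = All.map hits touching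
  where
  hits : ∀ {s} → Q (proj₁ s) ⊎ Q (proj₂ s) → ¬ Traverses x y s
  hits (inj₁ Qx) forward  = ¬Qx Qx
  hits (inj₁ Qy) backward = ¬Qy Qy
  hits (inj₂ Qy) forward  = ¬Qy Qy
  hits (inj₂ Qx) backward = ¬Qx Qx

-- Euler circuits

NoEdge : (A → A → Set p) → A → A → Set p
NoEdge G x y = ¬ G x y × ¬ G y x

none-NoEdge : ∀ {G : A → A → Set p} {x y ss} → All (uncurry G) ss → NoEdge G x y →
              None (Traverses x y) ss
none-NoEdge edges (¬Gxy , ¬Gyx) =
  All.map (λ { Gxy forward → ¬Gxy Gxy ; Gyx backward → ¬Gyx Gyx }) edges

record IsEulerCircuit {A : Set a} (G : A → A → Set p) (u : A) (vs : List A) : Set (a ⊔ p) where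
  field
    closed : endpoint u vs ≡ u
    edges  : All (uncurry G) (steps u vs)
    once   : ∀ {x y} → G x y → ExactlyOnce (Traverses x y) (steps u vs)

stepAt : (u : A) (vs : List A) → Fin (length vs) → A × A
stepAt u vs i = lookup (u ∷ vs) (inject₁ i) , lookup vs i

lookup-fromℕ : ∀ (u : A) vs → lookup (u ∷ vs) (fromℕ (length vs)) ≡ endpoint u vs
lookup-fromℕ u []       = refl
lookup-fromℕ u (v ∷ vs) = lookup-fromℕ v vs

All-stepAt : ∀ {R : A × A → Set p} u vs → All R (steps u vs) → ∀ i → R (stepAt u vs i)
All-stepAt u (v ∷ vs) (r ∷ _)  zero    = r
All-stepAt u (v ∷ vs) (_ ∷ rs) (suc i) = All-stepAt v vs rs i

Once-stepAt : ∀ {R : A × A → Set p} u vs → ExactlyOnce R (steps u vs) → ∃! _≡_ (R ∘ stepAt u vs)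
Once-stepAt u (v ∷ vs) (here r none) =
  zero , r , λ { {zero} _ → refl ; {suc j} rj → ⊥-elim (All-stepAt v vs none j rj) }
Once-stepAt u (v ∷ vs) (there ¬r once) with Once-stepAt v vs once
... | i , ri , unique =
  suc i , ri , λ { {zero} r₀ → ⊥-elim (¬r r₀) ; {suc j} rj → cong suc (unique rj) }

eulerian : ∀ {G : A → A → Set p} {u vs} → IsEulerCircuit G u vs → Eulerian G
eulerian {u = u} {vs} circuit =
  walk , λ _ _ Gxy → Once-stepAt u vs (Once.resp Traverses⇒≡ ≡⇒Traverses (once Gxy))
  where
  open IsEulerCircuit circuit
  walk : ClosedWalk _
  walk = record
    { len    = length vs
    ; vertex = lookup (u ∷ vs)
    ; closed = sym (trans (lookup-fromℕ u vs) closed)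
    ; steps  = All-stepAt u vs edges
    }

map-isEulerCircuit : ∀ {H : A → A → Set p} {G : B → B → Set e} {f : A → B} {u vs} →
  Injective _≡_ _≡_ f → (∀ {x y} → H x y → G (f x) (f y)) →
  (∀ {x y} → G x y → Σ[ (x′ , y′) ∈ A × A ] H x′ y′ × f x′ ≡ x × f y′ ≡ y) →
  IsEulerCircuit H u vs → IsEulerCircuit G (f u) (map f vs)
map-isEulerCircuit {G = G} {f} {u} {vs} f-inj H⇒G G⇒H circuit = record
  { closed = trans (endpoint-map f u vs) (cong f closed)
  ; edges  = subst (All (uncurry G)) (sym (steps-map f u vs)) (All.map⁺ (All.map H⇒G edges))
  ; once   = once′
  }
  where
  open IsEulerCircuit circuit
  once′ : ∀ {x y} → G x y → ExactlyOnce (Traverses x y) (steps (f u) (map f vs))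
  once′ Gxy with G⇒H Gxy
  ... | _ , Hxy , refl , refl = subst (ExactlyOnce _) (sym (steps-map f u vs))
    (Once.map⁺ (Once.resp (λ {s} → Traverses-map f s) (λ {s} → Traverses-map⁻ f-inj s) (once Hxy)))

++-isEulerCircuit : ∀ {G H Adj : A → A → Set p} {u xs ys} →
  (∀ {x y} → G x y → Adj x y) → (∀ {x y} → H x y → Adj x y) →
  (∀ {x y} → Adj x y → G x y × NoEdge H x y ⊎ H x y × NoEdge G x y) →
  IsEulerCircuit G u xs → IsEulerCircuit H u ys → IsEulerCircuit Adj u (xs ++ ys)
++-isEulerCircuit {Adj = Adj} {u} {xs} {ys} G⇒Adj H⇒Adj split circuitG circuitH = record
  { closed = trans (endpoint-++ u xs ys) (trans (cong (λ v → endpoint v ys) G.closed) H.closed)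
  ; edges  = subst (All (uncurry Adj)) (sym steps≡)
               (All.++⁺ (All.map G⇒Adj G.edges) (All.map H⇒Adj H.edges))
  ; once   = subst (ExactlyOnce _) (sym steps≡) ∘ once′
  }
  where
  module G = IsEulerCircuit circuitG
  module H = IsEulerCircuit circuitH
  steps≡ : steps u (xs ++ ys) ≡ steps u xs ++ steps u ys
  steps≡ = trans (steps-++ u xs ys) (cong (λ v → steps u xs ++ steps v ys) G.closed)
  once′ : ∀ {x y} → Adj x y → ExactlyOnce (Traverses x y) (steps u xs ++ steps u ys)
  once′ Adjxy with split Adjxy
  ... | inj₁ (Gxy , noH) = Once.++⁺ˡ (G.once Gxy) (none-NoEdge H.edges noH)
  ... | inj₂ (Hxy , noG) = Once.++⁺ʳ (none-NoEdge G.edges noG) (H.once Hxy)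

concatMap-isEulerCircuit : ∀ {I : Set b} {G : I → A → A → Set p} {Adj : A → A → Set p}
  {L : I → List A} {u is} → (∀ {i x y} → G i x y → Adj x y) →
  (∀ {x y} → Adj x y →
     Σ[ i ∈ I ] ExactlyOnce (i ≡_) is × G i x y × All (λ j → i ≢ j → NoEdge (G j) x y) is) →
  All (λ i → IsEulerCircuit (G i) u (L i)) is → IsEulerCircuit Adj u (concatMap L is)
concatMap-isEulerCircuit {G = G} {Adj} {L} {u} {is} G⇒Adj split circuits = record
  { closed = endpoint-concatMap L u (All.map IsEulerCircuit.closed circuits)
  ; edges  = subst (All (uncurry Adj)) (sym steps≡)
               (All.concat⁺ (All.map⁺ (All.map (All.map G⇒Adj ∘ IsEulerCircuit.edges) circuits)))
  ; once   = subst (ExactlyOnce _) (sym steps≡) ∘ once′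
  }
  where
  steps≡ : steps u (concatMap L is) ≡ concatMap (steps u ∘ L) is
  steps≡ = steps-concatMap L u (All.map IsEulerCircuit.closed circuits)
  once′ : ∀ {x y} → Adj x y → ExactlyOnce (Traverses x y) (concatMap (steps u ∘ L) is)
  once′ Adjxy with split Adjxy
  ... | i , i-once , Gixy , others = Once.concatMap⁺ i-once
    (IsEulerCircuit.once (All.lookup circuits (Once.toAny i-once)) Gixy)
    (All.zipWith (λ (circuit , noEdge) i≢j →
                    none-NoEdge (IsEulerCircuit.edges circuit) (noEdge i≢j))
                 (circuits , others))

-- An Euler circuit of the complete graph on 2m + 1 vertices

data Point (m : ℕ) : Set where
  hub        : Point m
  left right : Fin m → Point m

shift : ∀ {m} → Point m → Point (suc m)
shift hub       = hub
shift (left i)  = left (suc i)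
shift (right i) = right (suc i)

shift-injective : ∀ {m} → Injective _≡_ _≡_ (shift {m})
shift-injective {x = hub}     {hub}     _    = refl
shift-injective {x = left _}  {left _}  refl = refl
shift-injective {x = right _} {right _} refl = refl

data New {m} : Point (suc m) → Set where
  newˡ : New (left zero)
  newʳ : New (right zero)

¬New-shift : ∀ {m} (p : Point m) → ¬ New (shift p)
¬New-shift hub       ()
¬New-shift (left _)  ()
¬New-shift (right _) ()

new-or-shift : ∀ {m} (p : Point (suc m)) → New p ⊎ Σ[ p′ ∈ Point m ] shift p′ ≡ p
new-or-shift hub             = inj₂ (hub , refl)
new-or-shift (left zero)     = inj₁ newˡ
new-or-shift (left (suc i))  = inj₂ (left i , refl)
new-or-shift (right zero)    = inj₁ newʳ
new-or-shift (right (suc i)) = inj₂ (right i , refl)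

detour : ∀ {m} → Fin m → List (Point (suc m))
detour i = left (suc i) ∷ left zero ∷ right (suc i) ∷ right zero ∷ []

-- The edges at the new pair (left 0, right 0): the triangle hub → right 0 → left 0 → hub, with
-- the 4-cycle right 0 → left (1+i) → left 0 → right (1+i) → right 0 spliced in for each old pair i.
block : ∀ m → List (Point (suc m))
block m = right zero ∷ (concatMap detour (allFin m) ++ left zero ∷ hub ∷ [])

circuit : ∀ m → List (Point m)
circuit zero    = []
circuit (suc m) = block m ++ map shift (circuit m)

BlockEdge : ∀ {m} → Point (suc m) → Point (suc m) → Set
BlockEdge x y = x ≢ y × (New x ⊎ New y)

ShiftedEdge : ∀ {m} → Point (suc m) → Point (suc m) → Set
ShiftedEdge {m} x y = Σ[ (x′ , y′) ∈ Point m × Point m ] x′ ≢ y′ × shift x′ ≡ x × shift y′ ≡ y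

module Block (m : ℕ) where

  data OnPair (i : Fin m) : Point (suc m) → Set where
    onˡ : OnPair i (left (suc i))
    onʳ : OnPair i (right (suc i))

  detours : List (Point (suc m) × Point (suc m))
  detours = concatMap (steps (right zero) ∘ detour) (allFin m)

  blockSteps : List (Point (suc m) × Point (suc m))
  blockSteps = (hub , right zero) ∷ (detours ++ (right zero , left zero) ∷ (left zero , hub) ∷ [])

  steps-block : steps hub (block m) ≡ blockSteps
  steps-block = cong ((hub , right zero) ∷_) (begin
    steps (right zero) (concatMap detour (allFin m) ++ left zero ∷ hub ∷ [])
      ≡⟨ steps-++ (right zero) (concatMap detour (allFin m)) _ ⟩
    steps (right zero) (concatMap detour (allFin m)) ++
      steps (endpoint (right zero) (concatMap detour (allFin m))) (left zero ∷ hub ∷ [])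
      ≡⟨ cong₂ (λ ss v → ss ++ steps v (left zero ∷ hub ∷ []))
               (steps-concatMap detour (right zero) detours-closed)
               (endpoint-concatMap detour (right zero) detours-closed) ⟩
    detours ++ (right zero , left zero) ∷ (left zero , hub) ∷ [] ∎)
    where
    open ≡-Reasoning
    detours-closed : All (IsClosedAt detour (right zero)) (allFin m)
    detours-closed = All.universal (λ _ → refl) _

  detour-touches : ∀ i → All (λ (u , v) → OnPair i u ⊎ OnPair i v) (steps (right zero) (detour i))
  detour-touches i = inj₂ onˡ ∷ inj₁ onˡ ∷ inj₂ onʳ ∷ inj₁ onʳ ∷ []

  ¬OnPair-left : ∀ {i j} → i ≢ j → ¬ OnPair j (left (suc i))
  ¬OnPair-left i≢j onˡ = i≢j refl

  ¬OnPair-right : ∀ {i j} → i ≢ j → ¬ OnPair j (right (suc i))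
  ¬OnPair-right i≢j onʳ = i≢j refl

  detours-none : ∀ {x y} → (∀ {j} → ¬ OnPair j x) → (∀ {j} → ¬ OnPair j y) →
                 None (Traverses x y) detours
  detours-none ¬x ¬y =
    All.concat⁺ (All.map⁺ (All.universal (λ j → none-touching (detour-touches j) ¬x ¬y) (allFin m)))

  detours-once : ∀ {x y} i → (∀ {j} → ¬ OnPair j x) → (∀ {j} → i ≢ j → ¬ OnPair j y) →
                 ExactlyOnce (Traverses x y) (steps (right zero) (detour i)) →
                 ExactlyOnce (Traverses x y) detours
  detours-once i ¬x ¬y once = Once.concatMap⁺ (allFin-once i) once
    (All.universal (λ j i≢j → none-touching (detour-touches j) ¬x (¬y i≢j)) (allFin m))

  once-new : ∀ {x y} → New x → x ≢ y → ExactlyOnce (Traverses x y) blockSteps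
  once-new {y = hub} newˡ _ =
    there (λ ()) (Once.++⁺ʳ (detours-none (λ ()) (λ ())) (there (λ ()) (here forward [])))
  once-new {y = left zero} newˡ x≢y = ⊥-elim (x≢y refl)
  once-new {y = right zero} newˡ _ =
    there (λ ()) (Once.++⁺ʳ (detours-none (λ ()) (λ ())) (here backward ((λ ()) ∷ [])))
  once-new {y = left (suc i)} newˡ _ =
    there (λ ()) (Once.++⁺ˡ (detours-once i (λ ()) ¬OnPair-left
      (there (λ ()) (here backward ((λ ()) ∷ (λ ()) ∷ [])))) ((λ ()) ∷ (λ ()) ∷ []))
  once-new {y = right (suc i)} newˡ _ =
    there (λ ()) (Once.++⁺ˡ (detours-once i (λ ()) ¬OnPair-right
      (there (λ ()) (there (λ ()) (here forward ((λ ()) ∷ []))))) ((λ ()) ∷ (λ ()) ∷ []))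
  once-new {y = hub} newʳ _ =
    here backward (All.++⁺ (detours-none (λ ()) (λ ())) ((λ ()) ∷ (λ ()) ∷ []))
  once-new {y = left zero} newʳ _ =
    there (λ ()) (Once.++⁺ʳ (detours-none (λ ()) (λ ())) (here forward ((λ ()) ∷ [])))
  once-new {y = right zero} newʳ x≢y = ⊥-elim (x≢y refl)
  once-new {y = left (suc i)} newʳ _ =
    there (λ ()) (Once.++⁺ˡ (detours-once i (λ ()) ¬OnPair-left
      (here forward ((λ ()) ∷ (λ ()) ∷ (λ ()) ∷ []))) ((λ ()) ∷ (λ ()) ∷ []))
  once-new {y = right (suc i)} newʳ _ =
    there (λ ()) (Once.++⁺ˡ (detours-once i (λ ()) ¬OnPair-right
      (there (λ ()) (there (λ ()) (there (λ ()) (here backward []))))) ((λ ()) ∷ (λ ()) ∷ []))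

  blockEdges : All (uncurry BlockEdge) blockSteps
  blockEdges = ((λ ()) , inj₂ newʳ)
    ∷ All.++⁺ (All.concat⁺ (All.map⁺ (All.universal detourEdges (allFin m))))
              (((λ ()) , inj₁ newʳ) ∷ ((λ ()) , inj₁ newˡ) ∷ [])
    where
    detourEdges : ∀ i → All (uncurry BlockEdge) (steps (right zero) (detour i))
    detourEdges i = ((λ ()) , inj₁ newʳ) ∷ ((λ ()) , inj₂ newˡ)
                  ∷ ((λ ()) , inj₁ newˡ) ∷ ((λ ()) , inj₂ newʳ) ∷ []

  isEulerCircuit : IsEulerCircuit BlockEdge hub (block m)
  isEulerCircuit = record
    { closed = endpoint-++ (right zero) (concatMap detour (allFin m)) (left zero ∷ hub ∷ [])
    ; edges  = subst (All (uncurry BlockEdge)) (sym steps-block) blockEdges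
    ; once   = subst (ExactlyOnce _) (sym steps-block) ∘ once
    }
    where
    once : ∀ {x y} → BlockEdge x y → ExactlyOnce (Traverses x y) blockSteps
    once (x≢y , inj₁ new-x) = once-new new-x x≢y
    once (x≢y , inj₂ new-y) = Once.resp Traverses-sym Traverses-sym (once-new new-y (x≢y ∘ sym))

¬ShiftedEdgeˡ : ∀ {m} {x y : Point (suc m)} → New x → ¬ ShiftedEdge x y
¬ShiftedEdgeˡ new-x (_ , _ , refl , _) = ¬New-shift _ new-x

¬ShiftedEdgeʳ : ∀ {m} {x y : Point (suc m)} → New y → ¬ ShiftedEdge x y
¬ShiftedEdgeʳ new-y (_ , _ , _ , refl) = ¬New-shift _ new-y

¬BlockEdge-shift : ∀ {m} (x y : Point m) → ¬ BlockEdge (shift x) (shift y)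
¬BlockEdge-shift x _ (_ , inj₁ new) = ¬New-shift x new
¬BlockEdge-shift _ y (_ , inj₂ new) = ¬New-shift y new

split-edge : ∀ {m} {x y : Point (suc m)} → x ≢ y →
             BlockEdge x y × NoEdge ShiftedEdge x y ⊎ ShiftedEdge x y × NoEdge BlockEdge x y
split-edge {x = x} {y} x≢y with new-or-shift x | new-or-shift y
... | inj₁ new-x | _ = inj₁ ((x≢y , inj₁ new-x) , ¬ShiftedEdgeˡ new-x , ¬ShiftedEdgeʳ new-x)
... | inj₂ _ | inj₁ new-y = inj₁ ((x≢y , inj₂ new-y) , ¬ShiftedEdgeʳ new-y , ¬ShiftedEdgeˡ new-y)
... | inj₂ (x′ , refl) | inj₂ (y′ , refl) =
  inj₂ ((_ , x≢y ∘ cong shift , refl , refl) , ¬BlockEdge-shift x′ y′ , ¬BlockEdge-shift y′ x′)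

circuit-isEulerCircuit : ∀ m → IsEulerCircuit _≢_ hub (circuit m)
circuit-isEulerCircuit zero =
  record { closed = refl ; edges = [] ; once = λ { {hub} {hub} h → ⊥-elim (h refl) } }
circuit-isEulerCircuit (suc m) =
  ++-isEulerCircuit proj₁ (λ { (_ , x′≢y′ , refl , refl) → x′≢y′ ∘ shift-injective }) split-edge
    (Block.isEulerCircuit m)
    (map-isEulerCircuit shift-injective (λ x≢y → _ , x≢y , refl , refl) (λ e → e)
      (circuit-isEulerCircuit m))

index : ∀ {m} → Point m → Fin (suc (m ℕ.+ m))
index     hub       = zero
index {m} (left i)  = suc (i ↑ˡ m)
index {m} (right i) = suc (m ↑ʳ i)

index-injective : ∀ {m} → Injective _≡_ _≡_ (index {m})
index-injective {x = hub}     {hub}     _  = refl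
index-injective {m} {left i}  {left j}  eq = cong left (↑ˡ-injective m i j (suc-injective eq))
index-injective {m} {right i} {right j} eq = cong right (↑ʳ-injective m i j (suc-injective eq))
index-injective {m} {left i}  {right j} eq with
  trans (sym (splitAt-↑ˡ m i m)) (trans (cong (splitAt m) (suc-injective eq)) (splitAt-↑ʳ m m j))
... | ()
index-injective {m} {right i} {left j}  eq with
  trans (sym (splitAt-↑ˡ m j m))
        (trans (cong (splitAt m) (suc-injective (sym eq))) (splitAt-↑ʳ m m i))
... | ()

index-surjective : ∀ {m} (j : Fin (suc (m ℕ.+ m))) → Σ[ p ∈ Point m ] index p ≡ j
index-surjective zero = hub , refl
index-surjective {m} (suc j) with splitAt m j in eq
... | inj₁ i = left i , cong suc (splitAt⁻¹-↑ˡ eq)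
... | inj₂ i = right i , cong suc (splitAt⁻¹-↑ʳ eq)

-- Lines through 0 in Fⁿ

module FiniteField {c ℓ} (F : CommutativeRing c ℓ) {q} (isFiniteField : IsFiniteField F q) where

  open CommutativeRing F using (Carrier; _+_; _*_; -_; 0#; 1#)
  module R = CommutativeRing F
  open IsFiniteField isFiniteField using (≈⇒≡; inverse; counting)
  open Inverse counting using (to; from; strictlyInverseˡ; strictlyInverseʳ)
  open import Algebra.Properties.Ring R.ring using (-‿distribˡ-*; -‿distribʳ-*; +-inverseʳ-unique)
  open import Relation.Binary.Reasoning.Setoid R.setoid

  to-injective : Injective _≡_ _≡_ to
  to-injective {x} {y} tx≡ty =
    trans (sym (strictlyInverseʳ x)) (trans (cong from tx≡ty) (strictlyInverseʳ y))

  from-injective : Injective _≡_ _≡_ from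
  from-injective {i} {j} fi≡fj =
    trans (sym (strictlyInverseˡ i)) (trans (cong to fi≡fj) (strictlyInverseˡ j))

  _≟_ : DecidableEquality Carrier
  x ≟ y = Dec.map′ to-injective (cong to) (to x Fin.≟ to y)

  *-cancelˡ : ∀ {x y z} → x ≢ 0# → x * y ≡ x * z → y ≡ z
  *-cancelˡ {x} {y} {z} x≢0 xy≡xz with inverse x x≢0
  ... | x⁻¹ , x*x⁻¹≡1 = ≈⇒≡ (begin
    y               ≈⟨ R.*-identityˡ y ⟨
    1# * y          ≈⟨ R.*-congʳ x⁻¹*x≈1 ⟨
    (x⁻¹ * x) * y   ≈⟨ R.*-assoc x⁻¹ x y ⟩
    x⁻¹ * (x * y)   ≡⟨ cong (x⁻¹ *_) xy≡xz ⟩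
    x⁻¹ * (x * z)   ≈⟨ R.*-assoc x⁻¹ x z ⟨
    (x⁻¹ * x) * z   ≈⟨ R.*-congʳ x⁻¹*x≈1 ⟩
    1# * z          ≈⟨ R.*-identityˡ z ⟩
    z               ∎)
    where
    x⁻¹*x≈1 : x⁻¹ * x R.≈ 1#
    x⁻¹*x≈1 = R.trans (R.*-comm x⁻¹ x) (R.reflexive x*x⁻¹≡1)

  *-cancelʳ : ∀ {x y z} → x ≢ 0# → y * x ≡ z * x → y ≡ z
  *-cancelʳ {x} {y} {z} x≢0 yx≡zx =
    *-cancelˡ x≢0 (≈⇒≡ (R.trans (R.*-comm x y) (R.trans (R.reflexive yx≡zx) (R.*-comm z x))))

  relation⇒proportional : ∀ {λ′ μ} → μ ≢ 0# →
                          Σ[ κ ∈ Carrier ] ∀ {x y} → λ′ * x + μ * y ≡ 0# → y ≡ κ * x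
  relation⇒proportional {λ′} {μ} μ≢0 with inverse μ μ≢0
  ... | μ⁻¹ , μ*μ⁻¹≡1 = - (μ⁻¹ * λ′) , λ {x} {y} eq → ≈⇒≡ (begin
    y                    ≈⟨ R.*-identityˡ y ⟨
    1# * y               ≈⟨ R.*-congʳ μ⁻¹*μ≈1 ⟨
    (μ⁻¹ * μ) * y        ≈⟨ R.*-assoc μ⁻¹ μ y ⟩
    μ⁻¹ * (μ * y)        ≈⟨ R.*-congˡ (+-inverseʳ-unique (λ′ * x) (μ * y) (R.reflexive eq)) ⟩
    μ⁻¹ * - (λ′ * x)     ≈⟨ -‿distribʳ-* μ⁻¹ (λ′ * x) ⟨
    - (μ⁻¹ * (λ′ * x))   ≈⟨ R.-‿cong (R.*-assoc μ⁻¹ λ′ x) ⟨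
    - ((μ⁻¹ * λ′) * x)   ≈⟨ -‿distribˡ-* (μ⁻¹ * λ′) x ⟩
    - (μ⁻¹ * λ′) * x     ∎)
    where
    μ⁻¹*μ≈1 : μ⁻¹ * μ R.≈ 1#
    μ⁻¹*μ≈1 = R.trans (R.*-comm μ⁻¹ μ) (R.reflexive μ*μ⁻¹≡1)

  elements : List Carrier
  elements = tabulate from

  elements-once : ∀ x → ExactlyOnce (x ≡_) elements
  elements-once x = Once.tabulate⁺ (to x) (sym (strictlyInverseʳ x))
    (λ j j≢tox x≡fromj → j≢tox (trans (sym (strictlyInverseˡ j)) (cong to (sym x≡fromj))))

module Lines {c ℓ} (F : CommutativeRing c ℓ) {q} (isFiniteField : IsFiniteField F q) where

  open CommutativeRing F using (Carrier; _+_; _*_; -_; 0#; 1#)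
  open IsFiniteField isFiniteField using (≈⇒≡; 1≢0; inverse)
  open FiniteField F isFiniteField
  open import Algebra.Properties.Ring R.ring using (-‿distribˡ-*; -‿injective; -0#≈0#)
  import Relation.Binary.Reasoning.Setoid R.setoid as ≈-Reasoning
  open module Vectors {k} = VectorSpace F k using (_·_; _⊕_; 𝟎; LinearlyDependent₂; Adj)

  ·-zeroˡ : ∀ {k} (v : Vec Carrier k) → 0# · v ≡ 𝟎
  ·-zeroˡ v = trans (Vec.map-cong (≈⇒≡ ∘ R.zeroˡ) v) (Vec.map-const v 0#)

  ·-zeroʳ : ∀ {k} α → α · 𝟎 {k} ≡ 𝟎
  ·-zeroʳ {k} α = trans (Vec.map-replicate (α *_) 0# k) (cong (replicate k) (≈⇒≡ (R.zeroʳ α)))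

  ·-identityˡ : ∀ {k} (v : Vec Carrier k) → 1# · v ≡ v
  ·-identityˡ v = trans (Vec.map-cong (≈⇒≡ ∘ R.*-identityˡ) v) (Vec.map-id v)

  ·-assoc : ∀ {k} α β (v : Vec Carrier k) → (α * β) · v ≡ α · (β · v)
  ·-assoc α β v = trans (Vec.map-cong (≈⇒≡ ∘ R.*-assoc α β) v) (Vec.map-∘ (α *_) (β *_) v)

  ·-cancelˡ : ∀ {k α} {u v : Vec Carrier k} → α ≢ 0# → α · u ≡ α · v → u ≡ v
  ·-cancelˡ {u = []}    {[]}    _   _  = refl
  ·-cancelˡ {u = _ ∷ _} {_ ∷ _} α≢0 eq =
    cong₂ _∷_ (*-cancelˡ α≢0 (Vec.∷-injectiveˡ eq)) (·-cancelˡ α≢0 (Vec.∷-injectiveʳ eq))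

  ·-cancelʳ : ∀ {k α β} {v : Vec Carrier k} → v ≢ 𝟎 → α · v ≡ β · v → α ≡ β
  ·-cancelʳ {v = []}    v≢𝟎 _ = ⊥-elim (v≢𝟎 refl)
  ·-cancelʳ {v = x ∷ v} v≢𝟎 eq with x ≟ 0#
  ... | yes refl = ·-cancelʳ (v≢𝟎 ∘ cong (0# ∷_)) (Vec.∷-injectiveʳ eq)
  ... | no x≢0   = *-cancelʳ x≢0 (Vec.∷-injectiveˡ eq)

  combination≡𝟎⇒multiple : ∀ {k λ′ μ κ} {a b : Vec Carrier k} →
                           (∀ {x y} → λ′ * x + μ * y ≡ 0# → y ≡ κ * x) →
                           (λ′ · a) ⊕ (μ · b) ≡ 𝟎 → b ≡ κ · a
  combination≡𝟎⇒multiple {a = []}    {[]}    _     _  = refl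
  combination≡𝟎⇒multiple {a = _ ∷ _} {_ ∷ _} solve eq =
    cong₂ _∷_ (solve (Vec.∷-injectiveˡ eq)) (combination≡𝟎⇒multiple solve (Vec.∷-injectiveʳ eq))

  dependent⇒multiple : ∀ {k} {a b : Vec Carrier k} → LinearlyDependent₂ a b →
                       (Σ[ κ ∈ Carrier ] b ≡ κ · a) ⊎ (Σ[ κ ∈ Carrier ] a ≡ κ · b)
  dependent⇒multiple {a = a} {b} (λ′ , μ , nontrivial , eq) with μ ≟ 0#
  ... | no μ≢0 = inj₁ (_ , combination≡𝟎⇒multiple (proj₂ (relation⇒proportional μ≢0)) eq)
  ... | yes refl = inj₂ (_ , combination≡𝟎⇒multiple (proj₂ (relation⇒proportional λ′≢0))
                               (trans (Vec.zipWith-comm +-comm (0# · b) (λ′ · a)) eq))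
    where
    λ′≢0 : λ′ ≢ 0#
    λ′≢0 λ′≡0 = nontrivial (λ′≡0 , refl)
    +-comm : ∀ x y → x + y ≡ y + x
    +-comm x y = ≈⇒≡ (R.+-comm x y)

  multiples-dependent : ∀ {k} α β (r : Vec Carrier k) → (β · (α · r)) ⊕ ((- α) · (β · r)) ≡ 𝟎
  multiples-dependent α β []      = refl
  multiples-dependent α β (x ∷ r) = cong₂ _∷_ (≈⇒≡ (begin
    β * (α * x) + - α * (β * x)     ≈⟨ R.+-cong (R.*-assoc β α x) (-‿distribˡ-* α (β * x)) ⟨
    (β * α) * x + - (α * (β * x))   ≈⟨ R.+-congʳ (R.*-congʳ (R.*-comm β α)) ⟩
    (α * β) * x + - (α * (β * x))   ≈⟨ R.+-congʳ (R.*-assoc α β x) ⟩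
    α * (β * x) + - (α * (β * x))   ≈⟨ R.-‿inverseʳ (α * (β * x)) ⟩
    0#                              ∎)) (multiples-dependent α β r)
    where open ≈-Reasoning

  -- Every line through 𝟎 is spanned by exactly one vector whose first nonzero coordinate is 1.
  data Normalized : ∀ {k} → Vec Carrier k → Set c where
    leading : ∀ {k} {xs : Vec Carrier k} → Normalized (1# ∷ xs)
    skip    : ∀ {k} {xs : Vec Carrier k} → Normalized xs → Normalized (0# ∷ xs)

  Normalized⇒≢𝟎 : ∀ {k} {r : Vec Carrier k} → Normalized r → r ≢ 𝟎
  Normalized⇒≢𝟎 leading  eq = 1≢0 (Vec.∷-injectiveˡ eq)
  Normalized⇒≢𝟎 (skip n) eq = Normalized⇒≢𝟎 n (Vec.∷-injectiveʳ eq)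

  normalize : ∀ {k} (v : Vec Carrier k) → v ≢ 𝟎 →
              Σ[ (r , α) ∈ Vec Carrier k × Carrier ] Normalized r × v ≡ α · r
  normalize []       v≢𝟎 = ⊥-elim (v≢𝟎 refl)
  normalize (x ∷ xs) v≢𝟎 with x ≟ 0#
  ... | yes refl =
    let (r , α) , n , xs≡αr = normalize xs (v≢𝟎 ∘ cong (0# ∷_))
    in (0# ∷ r , α) , skip n , cong₂ _∷_ (sym (≈⇒≡ (R.zeroʳ α))) xs≡αr
  ... | no x≢0 with inverse x x≢0
  ...   | x⁻¹ , x*x⁻¹≡1 =
    (1# ∷ x⁻¹ · xs , x) , leading , cong₂ _∷_ (sym (≈⇒≡ (R.*-identityʳ x))) (begin
    xs                ≡⟨ ·-identityˡ xs ⟨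
    1# · xs           ≡⟨ cong (_· xs) x*x⁻¹≡1 ⟨
    (x * x⁻¹) · xs    ≡⟨ ·-assoc x x⁻¹ xs ⟩
    x · (x⁻¹ · xs)    ∎)
    where open ≡-Reasoning

  OnLine : ∀ {k} → Vec Carrier k → Vec Carrier k → Set c
  OnLine r x = Σ[ α ∈ Carrier ] x ≡ α · r

  normalized-unique : ∀ {k} {r r′ x : Vec Carrier k} → Normalized r → Normalized r′ →
                      OnLine r x → OnLine r′ x → x ≢ 𝟎 → r ≡ r′
  normalized-unique {r = r} {r′} leading leading (α , x≡αr) (β , x≡βr′) x≢𝟎 =
    cong (1# ∷_) (·-cancelˡ α≢0 (Vec.∷-injectiveʳ (trans αr≡βr′ (cong (_· r′) (sym α≡β)))))
    where
    αr≡βr′ : α · r ≡ β · r′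
    αr≡βr′ = trans (sym x≡αr) x≡βr′
    α≡β : α ≡ β
    α≡β = ≈⇒≡ (R.trans (R.sym (R.*-identityʳ α))
      (R.trans (R.reflexive (Vec.∷-injectiveˡ αr≡βr′)) (R.*-identityʳ β)))
    α≢0 : α ≢ 0#
    α≢0 α≡0 = x≢𝟎 (trans x≡αr (trans (cong (_· r) α≡0) (·-zeroˡ r)))
  normalized-unique {r = r} leading (skip _) (α , x≡αr) (β , x≡βr′) x≢𝟎 =
    ⊥-elim (x≢𝟎 (trans x≡αr (trans (cong (_· r) α≡0) (·-zeroˡ r))))
    where
    α≡0 : α ≡ 0#
    α≡0 = ≈⇒≡ (R.trans (R.sym (R.*-identityʳ α))
      (R.trans (R.reflexive (Vec.∷-injectiveˡ (trans (sym x≡αr) x≡βr′))) (R.zeroʳ β)))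
  normalized-unique (skip n) leading onLine onLine′ x≢𝟎 =
    sym (normalized-unique leading (skip n) onLine′ onLine x≢𝟎)
  normalized-unique {x = _ ∷ _} (skip n) (skip n′) (α , x≡αr) (β , x≡βr′) x≢𝟎 =
    cong (0# ∷_) (normalized-unique n n′ (α , Vec.∷-injectiveʳ x≡αr) (β , Vec.∷-injectiveʳ x≡βr′)
      (λ xs≡𝟎 → x≢𝟎 (cong₂ _∷_ (trans (Vec.∷-injectiveˡ x≡αr) (≈⇒≡ (R.zeroʳ α))) xs≡𝟎)))

  LineEdge : ∀ {k} → Vec Carrier k → Vec Carrier k → Vec Carrier k → Set c
  LineEdge r x y = x ≢ y × OnLine r x × OnLine r y

  LineEdge-sym : ∀ {k} {r x y : Vec Carrier k} → LineEdge r x y → LineEdge r y x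
  LineEdge-sym (x≢y , onLine-x , onLine-y) = x≢y ∘ sym , onLine-y , onLine-x

  LineEdge⇒Adj : ∀ {k} {r x y : Vec Carrier k} → LineEdge r x y → Adj x y
  LineEdge⇒Adj {r = r} (x≢y , (α , refl) , (β , refl)) =
    x≢y , β , - α , nontrivial , multiples-dependent α β r
    where
    nontrivial : ¬ (β ≡ 0# × - α ≡ 0#)
    nontrivial (β≡0 , -α≡0) = x≢y (cong (_· r) (trans α≡0 (sym β≡0)))
      where
      α≡0 : α ≡ 0#
      α≡0 = ≈⇒≡ (-‿injective (R.trans (R.reflexive -α≡0) (R.sym -0#≈0#)))

  on-common-line : ∀ {k κ} {a b : Vec Carrier k} → a ≢ b → b ≡ κ · a →
                   Σ[ r ∈ Vec Carrier k ] Normalized r × LineEdge r a b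
  on-common-line {κ = κ} {a} {b} a≢b b≡κa =
    let (r , α) , n , a≡αr = normalize a a≢𝟎
    in r , n , a≢b , (α , a≡αr) ,
       (κ * α , trans b≡κa (trans (cong (κ ·_) a≡αr) (sym (·-assoc κ α r))))
    where
    a≢𝟎 : a ≢ 𝟎
    a≢𝟎 a≡𝟎 = a≢b (trans a≡𝟎 (sym (trans b≡κa (trans (cong (κ ·_) a≡𝟎) (·-zeroʳ κ)))))

  Adj⇒LineEdge : ∀ {k} {x y : Vec Carrier k} → Adj x y →
                 Σ[ r ∈ Vec Carrier k ] Normalized r × LineEdge r x y
  Adj⇒LineEdge (x≢y , dependent) with dependent⇒multiple dependent
  ... | inj₁ (_ , y≡κx) = on-common-line x≢y y≡κx
  ... | inj₂ (_ , x≡κy) = Product.map₂ (Product.map₂ LineEdge-sym) (on-common-line (x≢y ∘ sym) x≡κy)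

  LineEdge-unique : ∀ {k} {r r′ x y : Vec Carrier k} → Normalized r → Normalized r′ →
                    LineEdge r x y → LineEdge r′ x y → r ≡ r′
  LineEdge-unique {x = x} {y} n n′ (x≢y , rx , ry) (_ , r′x , r′y) with Vec.≡-dec _≟_ x 𝟎
  ... | no x≢𝟎    = normalized-unique n n′ rx r′x x≢𝟎
  ... | yes x≡𝟎 = normalized-unique n n′ ry r′y (λ y≡𝟎 → x≢y (trans x≡𝟎 (sym y≡𝟎)))

  vectors : ∀ k → List (Vec Carrier k)
  vectors zero    = [] ∷ []
  vectors (suc k) = concatMap (λ x → map (x ∷_) (vectors k)) elements

  vectors-once : ∀ {k} (v : Vec Carrier k) → ExactlyOnce (v ≡_) (vectors k)
  vectors-once []               = here refl []
  vectors-once {suc k} (x ∷ xs) = Once.concatMap⁺ (elements-once x)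
    (Once.map⁺ (Once.resp (cong (x ∷_)) Vec.∷-injectiveʳ (vectors-once xs)))
    (All.universal (λ _ x≢y → All.map⁺ (All.universal (λ _ → x≢y ∘ Vec.∷-injectiveˡ) (vectors k)))
                   elements)

  normalizedVectors : ∀ k → List (Vec Carrier k)
  normalizedVectors zero    = []
  normalizedVectors (suc k) = map (1# ∷_) (vectors k) ++ map (0# ∷_) (normalizedVectors k)

  normalizedVectors-normalized : ∀ k → All Normalized (normalizedVectors k)
  normalizedVectors-normalized zero    = []
  normalizedVectors-normalized (suc k) =
    All.++⁺ (All.map⁺ (All.universal (λ _ → leading) (vectors k)))
            (All.map⁺ (All.map skip (normalizedVectors-normalized k)))

  normalizedVectors-once : ∀ {k} {r : Vec Carrier k} → Normalized r →
                           ExactlyOnce (r ≡_) (normalizedVectors k)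
  normalizedVectors-once {suc k} {_ ∷ xs} leading = Once.++⁺ˡ
    (Once.map⁺ (Once.resp (cong (1# ∷_)) Vec.∷-injectiveʳ (vectors-once xs)))
    (All.map⁺ (All.universal (λ _ → 1≢0 ∘ Vec.∷-injectiveˡ) (normalizedVectors k)))
  normalizedVectors-once {suc k} (skip n) = Once.++⁺ʳ
    (All.map⁺ (All.universal (λ _ → 1≢0 ∘ sym ∘ Vec.∷-injectiveˡ) (vectors k)))
    (Once.map⁺ (Once.resp (cong (0# ∷_)) Vec.∷-injectiveʳ (normalizedVectors-once n)))

-- The linear dependence graph

module LinearDependenceGraph
  {c ℓ} (F : CommutativeRing c ℓ) {m} (isFiniteField : IsFiniteField F (suc (m ℕ.+ m))) where

  open CommutativeRing F using (Carrier; _+_; -_; 0#)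
  open IsFiniteField isFiniteField using (≈⇒≡; counting)
  open Inverse counting using (to; from; strictlyInverseʳ)
  open FiniteField F isFiniteField using (module R; from-injective)
  open Lines F isFiniteField
  open Vectors using (_·_; 𝟎; Adj)
  open import Algebra.Properties.Ring R.ring using (+-cancelʳ; //-rightDividesʳ)

  -- Translated so that the hub goes to 0, which makes every line walk start and end at 𝟎.
  scalar : Point m → Carrier
  scalar p = from (index p) + - from zero

  scalar-hub : scalar hub ≡ 0#
  scalar-hub = ≈⇒≡ (R.-‿inverseʳ (from zero))

  scalar-injective : Injective _≡_ _≡_ scalar
  scalar-injective eq =
    index-injective (from-injective (≈⇒≡ (+-cancelʳ (- from zero) _ _ (R.reflexive eq))))

  scalar-surjective : ∀ α → Σ[ p ∈ Point m ] scalar p ≡ α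
  scalar-surjective α with index-surjective (to (α + from zero))
  ... | p , index-p≡ = p , (begin
    from (index p) + - from zero             ≡⟨ cong (λ i → from i + - from zero) index-p≡ ⟩
    from (to (α + from zero)) + - from zero  ≡⟨ cong (_+ - from zero) (strictlyInverseʳ _) ⟩
    (α + from zero) + - from zero            ≡⟨ ≈⇒≡ (//-rightDividesʳ (from zero) α) ⟩
    α                                        ∎)
    where open ≡-Reasoning

  line : ∀ {n} → Vec Carrier n → List (Vec Carrier n)
  line r = map (λ p → scalar p · r) (circuit m)

  line-isEulerCircuit : ∀ {n} {r : Vec Carrier n} → r ≢ 𝟎 → IsEulerCircuit (LineEdge r) 𝟎 (line r)
  line-isEulerCircuit {r = r} r≢𝟎 =
    subst (λ u → IsEulerCircuit (LineEdge r) u (line r))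
          (trans (cong (_· r) scalar-hub) (·-zeroˡ r))
      (map-isEulerCircuit injective (λ p≢p′ → p≢p′ ∘ injective , (_ , refl) , (_ , refl)) preimage
        (circuit-isEulerCircuit m))
    where
    injective : Injective _≡_ _≡_ (λ p → scalar p · r)
    injective = scalar-injective ∘ ·-cancelʳ r≢𝟎
    preimage : ∀ {x y} → LineEdge r x y →
               Σ[ (p , p′) ∈ Point m × Point m ] p ≢ p′ × scalar p · r ≡ x × scalar p′ · r ≡ y
    preimage (x≢y , (α , refl) , (β , refl)) with scalar-surjective α | scalar-surjective β
    ... | p , refl | p′ , refl =
      (p , p′) , (λ p≡p′ → x≢y (cong (λ p → scalar p · r) p≡p′)) , refl , refl

  isEulerCircuit : ∀ n → IsEulerCircuit Adj 𝟎 (concatMap line (normalizedVectors n))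
  isEulerCircuit n = concatMap-isEulerCircuit LineEdge⇒Adj split
    (All.map (line-isEulerCircuit ∘ Normalized⇒≢𝟎) (normalizedVectors-normalized n))
    where
    split : ∀ {x y} → Adj x y →
            Σ[ r ∈ Vec Carrier n ] ExactlyOnce (r ≡_) (normalizedVectors n) × LineEdge r x y ×
              All (λ r′ → r ≢ r′ → NoEdge (LineEdge r′) x y) (normalizedVectors n)
    split adj with Adj⇒LineEdge adj
    ... | r , normalized , edge = r , normalizedVectors-once normalized , edge ,
      All.map (λ normalized′ r≢r′ →
                 r≢r′ ∘ LineEdge-unique normalized normalized′ edge ,
                 r≢r′ ∘ LineEdge-unique normalized normalized′ (LineEdge-sym edge))
              (normalizedVectors-normalized n)

odd⇒≡suc[m+m] : ∀ q → q % 2 ≡ 1 → Σ[ m ∈ ℕ ] q ≡ suc (m ℕ.+ m)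
odd⇒≡suc[m+m] q q%2≡1 = q / 2 , (begin
  q                              ≡⟨ m≡m%n+[m/n]*n q 2 ⟩
  q % 2 ℕ.+ q / 2 ℕ.* 2          ≡⟨ cong (ℕ._+ q / 2 ℕ.* 2) q%2≡1 ⟩
  suc (q / 2 ℕ.* 2)              ≡⟨ cong suc (*-comm (q / 2) 2) ⟩
  suc (q / 2 ℕ.+ (q / 2 ℕ.+ 0))  ≡⟨ cong (λ k → suc (q / 2 ℕ.+ k)) (+-identityʳ (q / 2)) ⟩
  suc (q / 2 ℕ.+ q / 2)          ∎)
  where open ≡-Reasoning

mainTheorem8 : ∀ {c ℓ} (F : CommutativeRing c ℓ) (q n : ℕ) →
    IsFiniteField F q → n ≥ 1 → q % 2 ≡ 1 →
    Eulerian (VectorSpace.Adj F n)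
mainTheorem8 F q n isFiniteField _ q-odd with odd⇒≡suc[m+m] q q-odd
... | m , refl = eulerian (LinearDependenceGraph.isEulerCircuit F {m} isFiniteField n)
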